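{- For any $\mathbb{N}$-formula $\varphi$ in normal form and any forcing condition $p$, it is not the case that both $p\Vdash_\mathcal{A}\varphi$ and $p\Vdash_\mathcal{A}neg(\varphi)$.
   Context: Let $\tau$ be a countable relational vocabulary with $=,\neq$ and $\mathcal{A}$ a $\tau$-structure with universe $\omega$. Fix an effective enumeration $(\phi^{at}_n)$ of atomic $\tau$-formulas with free variables of $\phi^{at}_n$ among $x_0,\dots,x_n$. $\mathbb{N}$-formulas in normal form: built from atoms $\top,\bot,D(\mathbf n)$ without quantifiers; $\mathbb{N}$-$\Sigma^p_0$ = finite conjunctions of atoms; $\mathbb{N}$-$\Pi^p_0$ = finite disjunctions of negated atoms; $\mathbb{N}$-$\Sigma^p_1$/$\mathbb{N}$-$\Pi^p_1$ = countable disjunctions of $\mathbb{N}$-$\Sigma^p_0$ / conjunctions of $\mathbb{N}$-$\Pi^p_0$; for $\alpha\ge2$, $\mathbb{N}$-$\Sigma^p_\alpha$ = $\bigvee_i(\phi_i\wedge\theta_i)$ and $\mathbb{N}$-$\Pi^p_\alpha$ = $\bigwedge_i(\phi_i\vee\theta_i)$, $\phi_i\in\mathbb{N}$-$\Sigma^p_{\beta_i}$, $\theta_i\in\mathbb{N}$-$\Pi^p_{\beta_i}$, $0<\beta_i<\alpha$. $neg(\varphi)$ swaps each atom with its negation and $\bigvee\leftrightarrow\bigwedge$, $\wedge\leftrightarrow\vee$ (recursively), mapping $\mathbb{N}$-$\Sigma^p_\alpha$ to $\mathbb{N}$-$\Pi^p_\alpha$ and vice versa. Forcing conditions: finite tuples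 $p=(p_0,\dots,p_{k-1})$ of distinct natural numbers, ordered by extension $\subseteq$. Forcing $\Vdash_\mathcal{A}$: $p\Vdash\top$, $p\not\Vdash\bot$; $p\Vdash D(\mathbf n)$ iff all variables $x_i$ of $\phi^{at}_n$ satisfy $i<k$ and $\mathcal{A}\models\phi^{at}_n[x_i\mapsto p_i]$; a finite conjunction of atoms is forced iff each conjunct is; an $\mathbb{N}$-$\Sigma^p_1$ formula $\bigvee_i\phi_i$ is forced iff some $\phi_i$ is; an $\mathbb{N}$-$\Sigma^p_\alpha$ ($\alpha\ge2$) formula $\bigvee_i(\phi_i\wedge\theta_i)$ is forced iff for some $i$ both $\phi_i$ and $\theta_i$ are forced; an $\mathbb{N}$-$\Pi^p_\alpha$ formula $\varphi$ ($\alpha\ge0$) is forced by $p$ iff no $q\supseteq p$ forces $neg(\varphi)$. -}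

module Defs where

open import Data.Nat using (ℕ; zero; suc; _≤_; _<_)
open import Data.List using (List; []; _∷_; _++_; length)
open import Data.List.Relation.Unary.All using (All)
open import Data.List.Relation.Unary.Unique.Propositional using (Unique)
open import Data.Vec using (Vec; toList; map)
open import Data.Maybe using (Maybe; just; nothing)
open import Data.Product using (Σ; ∃; ∃-syntax; _×_; _,_)
open import Data.Unit using (⊤)
open import Data.Empty using (⊥)
open import Function.Definitions using (Injective)
open import Relation.Binary.PropositionalEquality using (_≡_)
open import Relation.Nullary using (¬_)

record Vocabulary : Set₁ where
  field
    Rel      : Set
    arity    : Rel → ℕ
    code     : Rel → ℕ
    code-inj : Injective _≡_ _≡_ code
open Vocabulary public

record Structure (τ : Vocabulary) : Set₁ where
  field
    interp : (R : Rel τ) → Vec ℕ (arity τ R) → Set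
open Structure public

-- Atomic τ-formulas; variable x_i is represented by the index i.
data AtomicF (τ : Vocabulary) : Set where
  equ : ℕ → ℕ → AtomicF τ
  neq : ℕ → ℕ → AtomicF τ
  rel : (R : Rel τ) → Vec ℕ (arity τ R) → AtomicF τ

vars : {τ : Vocabulary} → AtomicF τ → List ℕ
vars (equ i j)  = i ∷ j ∷ []
vars (neq i j)  = i ∷ j ∷ []
vars (rel R vs) = toList vs

Sat : {τ : Vocabulary} → Structure τ → AtomicF τ → (ℕ → ℕ) → Set
Sat A (equ i j)  a = a i ≡ a j
Sat A (neq i j)  a = ¬ (a i ≡ a j)
Sat A (rel R vs) a = interp A R (map a vs)

record AtomEnum (τ : Vocabulary) : Set₁ where
  field
    enum  : ℕ → AtomicF τ
    bound : ∀ n → All (λ i → i ≤ n) (vars (enum n))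
    onto  : ∀ (φ : AtomicF τ) → ∃[ n ] (enum n ≡ φ)
open AtomEnum public

data Ord : Set where
  oz : Ord
  os : Ord → Ord
  ol : (ℕ → Ord) → Ord

data _≤o_ : Ord → Ord → Set where
  z≤o    : ∀ {a} → oz ≤o a
  s≤o    : ∀ {a b} → a ≤o b → os a ≤o os b
  ≤o-step : ∀ {a b} → a ≤o b → a ≤o os b
  ≤o-lim : ∀ {a f} k → a ≤o f k → a ≤o ol f
  lim≤o  : ∀ {f a} → (∀ k → f k ≤o a) → ol f ≤o a
  ≤o-trans : ∀ {a b c} → a ≤o b → b ≤o c → a ≤o c

_<o_ : Ord → Ord → Set
a <o b = os a ≤o b

one two : Ord
one = os oz
two = os one

data Atom : Set where
  ⊤a : Atom
  ⊥a : Atom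
  D  : ℕ → Atom

-- The Σ-reading and the Π-reading of a
-- skeleton are mutual negations:
--   sk0 as : Σ-reading ⋀ as          ; Π-reading ⋁ (¬ a) for a ∈ as
--   sk1 f  : Σ-reading ⋁_i ⋀ (f i)   ; Π-reading ⋀_i ⋁_{a∈f i} ¬ a
--   skH f  : Σ-reading ⋁_i (φ_i ∧ θ_i), φ_i = Σ-reading of s_i,
--                                       θ_i = Π-reading of t_i
--            Π-reading ⋀_i (φ'_i ∨ θ'_i), φ'_i = Σ-reading of t_i,
--                                         θ'_i = Π-reading of s_i
-- Countable disjunctions/conjunctions are indexed by ℕ, entries
-- `nothing` being absent (so finite and empty families are allowed).
mutual
  data Skel : Ord → Set where
    sk0 : List Atom → Skel oz
    sk1 : (ℕ → Maybe (List Atom)) → Skel one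
    skH : ∀ {α} → two ≤o α → (ℕ → Maybe (Comp α)) → Skel α

  record Comp (α : Ord) : Set where
    inductive
    constructor comp
    field
      β     : Ord
      β-pos : oz <o β
      β<α   : β <o α
      s     : Skel β
      t     : Skel β

data Pol : Set where
  σ π : Pol   -- σ : ℕ-Σ^p_α formula, π : ℕ-Π^p_α formula

record NFormula : Set where
  constructor nf
  field
    level : Ord
    pol   : Pol
    skel  : Skel level

flip : Pol → Pol
flip σ = π
flip π = σ

-- neg swaps atoms with negated atoms and ⋁↔⋀, ∧↔∨ recursively
neg : NFormula → NFormula
neg (nf α p s) = nf α (flip p) s

record Cond : Set where
  constructor cond
  field
    tuple    : List ℕ
    distinct : Unique tuple
open Cond public

-- q extends p
_≼_ : Cond → Cond → Set
p ≼ q = ∃[ r ] (tuple q ≡ tuple p ++ r)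

-- the assignment x_i ↦ p_i (the default 0 is never used for i ≥ k,
-- since forcing D(n) requires all variables to have index < k)
asg : List ℕ → ℕ → ℕ
asg []       _       = 0
asg (x ∷ xs) zero    = x
asg (x ∷ xs) (suc i) = asg xs i

module Forcing {τ : Vocabulary} (A : Structure τ) (E : AtomEnum τ) where

  forcesAtom : Cond → Atom → Set
  forcesAtom p ⊤a    = ⊤
  forcesAtom p ⊥a    = ⊥
  forcesAtom p (D n) =
    All (λ i → i < length (tuple p)) (vars (enum E n))
    × Sat A (enum E n) (asg (tuple p))

  mutual
    forcesΣ : ∀ {α} → Skel α → Cond → Set
    forcesΣ (sk0 as)  p = All (forcesAtom p) as
    forcesΣ (sk1 f)   p = ∃[ i ] ∃[ as ] (f i ≡ just as × All (forcesAtom p) as)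
    forcesΣ (skH _ f) p = ∃[ i ] forcesEntry (f i) p

    forcesEntry : ∀ {α} → Maybe (Comp α) → Cond → Set
    forcesEntry nothing                 p = ⊥
    forcesEntry (just (comp _ _ _ s t)) p = forcesΣ s p × forcesΠ t p

    -- p forces the Π-reading of a skeleton: no q ⊇ p forces its
    -- negation, which is the Σ-reading of the same skeleton
    forcesΠ : ∀ {α} → Skel α → Cond → Set
    forcesΠ s p = ¬ (∃[ q ] (p ≼ q × forcesΣ s q))

  _⊩_ : Cond → NFormula → Set
  p ⊩ nf α σ s = forcesΣ s p
  p ⊩ nf α π s = forcesΠ s p

{-# OPTIONS --safe #-}
module Submission where

open import Defs
open import Data.List using ([])
open import Data.List.Properties using (++-identityʳ)
open import Data.Product using (_×_; _,_)
open import Relation.Binary.PropositionalEquality using (sym)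
open import Relation.Nullary using (¬_)

≼-refl : (p : Cond) → p ≼ p
≼-refl p = [] , sym (++-identityʳ (tuple p))

module _ {τ : Vocabulary} (A : Structure τ) (E : AtomEnum τ) where
  open Forcing A E

  forcesΠ⇒¬forcesΣ : ∀ {α} (s : Skel α) (p : Cond) → forcesΠ s p → ¬ forcesΣ s p
  forcesΠ⇒¬forcesΣ s p ⊩Π ⊩Σ = ⊩Π (p , ≼-refl p , ⊩Σ)

mainTheorem7 : {τ : Vocabulary} (A : Structure τ) (E : AtomEnum τ)
    (φ : NFormula) (p : Cond) →
    ¬ (Forcing._⊩_ A E p φ × Forcing._⊩_ A E p (neg φ))
mainTheorem7 A E (nf α σ s) p (⊩Σ , ⊩Π) = forcesΠ⇒¬forcesΣ A E s p ⊩Π ⊩Σ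
mainTheorem7 A E (nf α π s) p (⊩Π , ⊩Σ) = forcesΠ⇒¬forcesΣ A E s p ⊩Π ⊩Σ
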